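{- Let $G=(V,E,\sigma)$ be a signed graph. For any two disjoint subsets $V_1,V_2\subseteq V$ (with $V_1\cup V_2\neq\emptyset$), $\beta(G[V_1\cup V_2])\leq\beta_G(V_1,V_2)$. Furthermore, for any nonempty $U\subseteq V$, $\beta(G[U])\leq\beta_G(U)$.
   Context: A signed graph $G=(V,E,\sigma)$ is a finite simple undirected graph with a sign $\sigma(e)\in\{+,-\}$ on each edge; $d_G(u)$ is the number of edges at $u$ (ignoring signs); $\operatorname{vol}_G(S)=\sum_{u\in S}d_G(u)$. For $V_1,V_2\subseteq V$, $E_G(V_1,V_2)$ is the set of edges with one endpoint in $V_1$ and one in $V_2$, $E^{\pm}_G(V_1,V_2)$ its positive/negative edges, and $|E^-_G(V_1)|$ is twice the number of negative edges inside $V_1$. For disjoint $V_1,V_2$ with nonempty union (a sub-bipartition), $e_G(V_1,V_2)=2|E^+_G(V_1,V_2)|+|E^-_G(V_1)|+|E^-_G(V_2)|+|E_G(V_1\cup V_2,V\setminus(V_1\cup V_2))|$ and $\beta_G(V_1,V_2)=e_G(V_1,V_2)/\operatorname{vol}_G(V_1\cup V_2)$. For nonempty $U$, $\beta_G(U)=\min\beta_G(V_1,V_2)$ over partitions $(V_1,V_2)$ of $U$ (one part may be empty). $\beta(G)=\min_{\emptyset\neq U\subseteq V}\beta_G(U)$. $G[U]$ is the induced signed subgraph on $U$, with its own degrees and volumes. -}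

module Defs where

open import Data.Nat as ℕ using (ℕ; zero; suc; _+_; _*_)
open import Data.Bool using (Bool; true; false; _∧_; _∨_; not; if_then_else_)
open import Data.Fin using (Fin)
open import Data.Fin.Subset using (Subset; _∩_; _∪_; _─_; ∁; ⊤)
open import Data.Vec using (Vec; []; _∷_; lookup)
open import Data.List using (List; []; _∷_; map; _++_; allFin; filter; foldr)
open import Data.Nat.ListAction using (sum)
open import Data.Maybe using (Maybe; just; nothing)
open import Data.Integer using (+_)
open import Data.Rational using (ℚ; _/_; _⊓_; 0ℚ)
open import Relation.Binary.PropositionalEquality using (_≡_)

data Sign : Set where
  pos neg : Sign

-- A finite simple signed graph: sgn u v = nothing means "no edge",
-- just s means an edge of sign s.  Symmetric, no loops.
record SignedGraph (n : ℕ) : Set where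
  field
    sgn       : Fin n → Fin n → Maybe Sign
    symmetric : ∀ u v → sgn u v ≡ sgn v u
    loopless  : ∀ u → sgn u u ≡ nothing
open SignedGraph public

Σ[_] : ∀ {n} → (Fin n → ℕ) → ℕ
Σ[_] {n} f = sum (map f (allFin n))

[_] : Bool → ℕ
[ true ] = 1
[ false ] = 0

_∈ᵇ_ : ∀ {n} → Fin n → Subset n → Bool
u ∈ᵇ S = lookup S u

isEdge : Maybe Sign → Bool
isEdge nothing = false
isEdge (just _) = true

isPos : Maybe Sign → Bool
isPos (just pos) = true
isPos _ = false

isNeg : Maybe Sign → Bool
isNeg (just neg) = true
isNeg _ = false

-- All quantities below are computed in the induced subgraph G[S]
-- (vertex set S, edges of G with both endpoints in S).  Taking S = ⊤
-- gives the quantities of G itself.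

sgnIn : ∀ {n} → SignedGraph n → Subset n → Fin n → Fin n → Maybe Sign
sgnIn G S u v = if (u ∈ᵇ S) ∧ (v ∈ᵇ S) then sgn G u v else nothing

deg : ∀ {n} → SignedGraph n → Subset n → Fin n → ℕ
deg G S u = Σ[ (λ v → [ isEdge (sgnIn G S u v) ]) ]

vol : ∀ {n} → SignedGraph n → Subset n → Subset n → ℕ
vol G S W = Σ[ (λ u → [ u ∈ᵇ W ] * deg G S u) ]

pairs : ∀ {n} → SignedGraph n → Subset n → (Maybe Sign → Bool) →
        Subset n → Subset n → ℕ
pairs G S p A B =
  Σ[ (λ u → Σ[ (λ v → [ (u ∈ᵇ A) ∧ ((v ∈ᵇ B) ∧ p (sgnIn G S u v)) ]) ]) ]

-- e_{G[S]}(V1,V2)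
--   = 2|E⁺(V1,V2)| + |E⁻(V1)| + |E⁻(V2)| + |E(V1 ∪ V2, S \ (V1 ∪ V2))|
-- (|E⁻(Vi)| is twice the number of negative edges inside Vi, i.e. the
-- number of ordered pairs inside Vi joined by a negative edge).
eG : ∀ {n} → SignedGraph n → Subset n → Subset n → Subset n → ℕ
eG G S V₁ V₂ =
  2 * pairs G S isPos V₁ V₂
  + pairs G S isNeg V₁ V₁
  + pairs G S isNeg V₂ V₂
  + pairs G S isEdge (V₁ ∪ V₂) (S ─ (V₁ ∪ V₂))

-- ratio a / b with the convention 0 / 0 = 0 (only arises when b = 0)
ratio : ℕ → ℕ → ℚ
ratio a zero = 0ℚ
ratio a (suc b) = (+ a) / suc b

βpair : ∀ {n} → SignedGraph n → Subset n → Subset n → Subset n → ℚ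
βpair G S V₁ V₂ = ratio (eG G S V₁ V₂) (vol G S (V₁ ∪ V₂))

allSubsets : (n : ℕ) → List (Subset n)
allSubsets zero = [] ∷ []
allSubsets (suc n) = map (true ∷_) (allSubsets n) ++ map (false ∷_) (allSubsets n)

-- minimum of a list (only applied to nonempty lists below)
minList : List ℚ → ℚ
minList [] = 0ℚ
minList (x ∷ xs) = foldr _⊓_ x xs

nonemptyᵇ : ∀ {n} → Subset n → Bool
nonemptyᵇ [] = false
nonemptyᵇ (b ∷ p) = b ∨ nonemptyᵇ p

-- β_{G[S]}(U) = min over partitions (V1, U \ V1) of U, V1 ranging over
-- all subsets of U (one part may be empty).
βset : ∀ {n} → SignedGraph n → Subset n → Subset n → ℚ
βset {n} G S U =
  minList (map (λ W → βpair G S (W ∩ U) (U ─ W)) (allSubsets n))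

β : ∀ {n} → SignedGraph n → Subset n → ℚ
β {n} G S =
  minList (map (βset G S) (filter (λ U → nonemptyᵇ U Data.Bool.≟ true)
                                   (map (_∩ S) (allSubsets n))))

-- Passing from the induced subgraph G[V₁ ∪ V₂] to G adds the same number, the edges
-- leaving V₁ ∪ V₂, to both the numerator e and the denominator vol of β(V₁, V₂).  Inside
-- G[V₁ ∪ V₂] the numerator is at most the denominator, since every ordered pair joined by an
-- edge is counted at most once, and a fraction at most 1 does not decrease when equal amounts
-- are added to numerator and denominator.  Together with β(G[S]) ≤ β_{G[S]}(S) ≤
-- β_{G[S]}(V₁, V₂) this gives the first claim; the second is the first applied to every
-- partition of U.

module Submission where

open import Defs
open import Data.Nat using (ℕ)
open import Data.Product using (_×_)
open import Data.Fin using (Fin)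
open import Data.Fin.Subset using (Subset; Nonempty; _∈_; _∉_; _∪_; ⊤)
open import Data.Rational using (_≤_)

open import Data.Bool using (true; false; _∧_; _∨_; not; if_then_else_)
open import Data.Bool.Properties using (∧-comm; ∧-zeroʳ; ∧-identityʳ; ∨-identityʳ)
open import Data.Fin.Subset using (_⊆_; _∩_; _─_; ⊥)
open import Data.Fin.Subset.Properties
  using (∩-idem; ∩-abs-∪; p⊆p∪q; q⊆p∪q; x∈p∩q⁻; Empty-unique)
import Data.Integer as ℤ
import Data.Integer.Properties as ℤₚ
open import Data.List using (List; []; _∷_; map; allFin)
open import Data.List.Membership.Propositional using () renaming (_∈_ to _∈ₗ_)
open import Data.List.Membership.Propositional.Properties
  using (∈-map⁺; ∈-filter⁺; ∈-++⁺ˡ; ∈-++⁺ʳ)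
open import Data.List.Properties using (map-cong; foldr-preservesᵒ; foldr-preservesᵇ)
open import Data.List.Relation.Unary.All using (All; _∷_; universal)
open import Data.List.Relation.Unary.All.Properties using (map⁺)
open import Data.List.Relation.Unary.Any as Any using (here; there)
open import Data.Maybe using (just; nothing)
open import Data.Nat as ℕ using (zero; suc; _+_; _*_; z≤n)
import Data.Nat.Properties as ℕₚ
open import Algebra.Properties.CommutativeSemigroup ℕₚ.+-commutativeSemigroup
  using () renaming (interchange to +-interchange)
open import Data.Nat.ListAction using (sum)
open import Data.Product using (_,_)
open import Data.Rational using (_/_; 0ℚ; fromℚᵘ; _⊓_)
import Data.Rational.Properties as ℚₚ
import Data.Rational.Unnormalised as ℚᵘ
import Data.Rational.Unnormalised.Properties as ℚᵘₚ
open import Data.Sum using (_⊎_; inj₁; inj₂)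
open import Data.Vec using ([]; _∷_; lookup; here; there)
open import Data.Vec.Properties
  using (lookup-zipWith; lookup-replicate; lookup⇒[]=; []=⇒lookup; ∷-injectiveʳ)
open import Relation.Binary.PropositionalEquality
  using (_≡_; refl; sym; trans; cong; cong₂; subst; subst₂; module ≡-Reasoning)

module _ {A : Set} where

  sum-map-zero : ∀ (xs : List A) → sum (map (λ _ → 0) xs) ≡ 0
  sum-map-zero []       = refl
  sum-map-zero (x ∷ xs) = sum-map-zero xs

  sum-map-cong : ∀ xs {f g : A → ℕ} → (∀ x → f x ≡ g x) → sum (map f xs) ≡ sum (map g xs)
  sum-map-cong xs f≗g = cong sum (map-cong f≗g xs)

  sum-map-mono : ∀ xs {f g : A → ℕ} → (∀ x → f x ℕ.≤ g x) →
                 sum (map f xs) ℕ.≤ sum (map g xs)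
  sum-map-mono []       f≤g = z≤n
  sum-map-mono (x ∷ xs) f≤g = ℕₚ.+-mono-≤ (f≤g x) (sum-map-mono xs f≤g)

  sum-map-+ : ∀ xs (f g : A → ℕ) →
              sum (map (λ x → f x + g x) xs) ≡ sum (map f xs) + sum (map g xs)
  sum-map-+ []       f g = refl
  sum-map-+ (x ∷ xs) f g =
    trans (cong ((f x + g x) +_) (sum-map-+ xs f g)) (+-interchange (f x) (g x) _ _)

  sum-map-*ˡ : ∀ xs c (f : A → ℕ) → sum (map (λ x → c * f x) xs) ≡ c * sum (map f xs)
  sum-map-*ˡ []       c f = sym (ℕₚ.*-zeroʳ c)
  sum-map-*ˡ (x ∷ xs) c f =
    trans (cong (c * f x +_) (sum-map-*ˡ xs c f)) (sym (ℕₚ.*-distribˡ-+ c (f x) _))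

sum-map-comm : ∀ {A B : Set} (xs : List A) (ys : List B) (f : A → B → ℕ) →
               sum (map (λ x → sum (map (f x) ys)) xs) ≡
               sum (map (λ y → sum (map (λ x → f x y) xs)) ys)
sum-map-comm []       ys f = sym (sum-map-zero ys)
sum-map-comm (x ∷ xs) ys f =
  trans (cong (sum (map (f x) ys) +_) (sum-map-comm xs ys f)) (sym (sum-map-+ ys (f x) _))

∧-exchange : ∀ x y z → x ∧ (y ∧ z) ≡ y ∧ (x ∧ z)
∧-exchange true  y z = refl
∧-exchange false y z = sym (∧-zeroʳ y)

module _ {n : ℕ} where

  lookup-⊤ : ∀ (i : Fin n) → lookup ⊤ i ≡ true
  lookup-⊤ i = lookup-replicate i true

  lookup-⊥ : ∀ (i : Fin n) → lookup ⊥ i ≡ false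
  lookup-⊥ i = lookup-replicate i false

  lookup-∪ : ∀ (p q : Subset n) i → lookup (p ∪ q) i ≡ lookup p i ∨ lookup q i
  lookup-∪ p q i = lookup-zipWith _∨_ i p q

  lookup-∩ : ∀ (p q : Subset n) i → lookup (p ∩ q) i ≡ lookup p i ∧ lookup q i
  lookup-∩ p q i = lookup-zipWith _∧_ i p q

  lookup-⊆ : ∀ {p q : Subset n} → p ⊆ q → ∀ {i} → lookup p i ≡ true → lookup q i ≡ true
  lookup-⊆ {p} p⊆q {i} pᵢ = []=⇒lookup (p⊆q (lookup⇒[]= i p pᵢ))

  p∩q≡⊥⇒lookup : ∀ {p q : Subset n} → p ∩ q ≡ ⊥ → ∀ i → lookup p i ∧ lookup q i ≡ false
  p∩q≡⊥⇒lookup {p} {q} p∩q≡⊥ i =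
    trans (sym (lookup-∩ p q i)) (trans (cong (λ r → lookup r i) p∩q≡⊥) (lookup-⊥ i))

  disjoint⇒p∩q≡⊥ : ∀ {p q : Subset n} → (∀ x → x ∈ p → x ∉ q) → p ∩ q ≡ ⊥
  disjoint⇒p∩q≡⊥ {p} {q} disj =
    Empty-unique λ (x , x∈p∩q) → let x∈p , x∈q = x∈p∩q⁻ p q x∈p∩q in disj x x∈p x∈q

lookup-─ : ∀ {n} (p q : Subset n) i → lookup (p ─ q) i ≡ lookup p i ∧ not (lookup q i)
lookup-─ (x ∷ p) (true  ∷ q) Fin.zero    = sym (∧-zeroʳ x)
lookup-─ (x ∷ p) (false ∷ q) Fin.zero    = sym (∧-identityʳ x)
lookup-─ (x ∷ p) (y     ∷ q) (Fin.suc i) = lookup-─ p q i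

p─p≡⊥ : ∀ {n} (p : Subset n) → p ─ p ≡ ⊥
p─p≡⊥ []          = refl
p─p≡⊥ (true  ∷ p) = cong (false ∷_) (p─p≡⊥ p)
p─p≡⊥ (false ∷ p) = cong (false ∷_) (p─p≡⊥ p)

p∩q≡⊥⇒p∪q─p≡q : ∀ {n} {p q : Subset n} → p ∩ q ≡ ⊥ → (p ∪ q) ─ p ≡ q
p∩q≡⊥⇒p∪q─p≡q {p = []}        {[]}        _     = refl
p∩q≡⊥⇒p∪q─p≡q {p = true  ∷ p} {false ∷ q} p∩q≡⊥ =
  cong (false ∷_) (p∩q≡⊥⇒p∪q─p≡q (∷-injectiveʳ p∩q≡⊥))
p∩q≡⊥⇒p∪q─p≡q {p = false ∷ p} {b     ∷ q} p∩q≡⊥ =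
  cong (b ∷_) (p∩q≡⊥⇒p∪q─p≡q (∷-injectiveʳ p∩q≡⊥))

p∩q∪q─p≡q : ∀ {n} (p q : Subset n) → (p ∩ q) ∪ (q ─ p) ≡ q
p∩q∪q─p≡q []          []      = refl
p∩q∪q─p≡q (true  ∷ p) (b ∷ q) = cong₂ _∷_ (∨-identityʳ b) (p∩q∪q─p≡q p q)
p∩q∪q─p≡q (false ∷ p) (b ∷ q) = cong (b ∷_) (p∩q∪q─p≡q p q)

p∩q∩q─p≡⊥ : ∀ {n} (p q : Subset n) → (p ∩ q) ∩ (q ─ p) ≡ ⊥
p∩q∩q─p≡⊥ []          []      = refl
p∩q∩q─p≡⊥ (true  ∷ p) (b ∷ q) = cong₂ _∷_ (∧-zeroʳ b) (p∩q∩q─p≡⊥ p q)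
p∩q∩q─p≡⊥ (false ∷ p) (b ∷ q) = cong (false ∷_) (p∩q∩q─p≡⊥ p q)

cut : ∀ {n} → SignedGraph n → Subset n → ℕ
cut G S = pairs G ⊤ isEdge S (⊤ ─ S)

frustration : ∀ {n} → SignedGraph n → Subset n → Subset n → Subset n → ℕ
frustration G S A B = 2 * pairs G S isPos A B + pairs G S isNeg A A + pairs G S isNeg B B

ΣΣ-+ : ∀ {n} (f g : Fin n → Fin n → ℕ) →
       Σ[ (λ u → Σ[ (λ v → f u v + g u v) ]) ] ≡ Σ[ (λ u → Σ[ f u ]) ] + Σ[ (λ u → Σ[ g u ]) ]
ΣΣ-+ {n} f g =
  trans (sum-map-cong (allFin n) λ u → sum-map-+ (allFin n) (f u) (g u)) (sum-map-+ (allFin n) _ _)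

edge-split : ∀ x y s →
  [ x ] * [ isEdge s ]
  ≡ [ x ] * [ isEdge (if x ∧ y then s else nothing) ] + [ x ∧ (not y ∧ isEdge s) ]
edge-split false y     s        = refl
edge-split true  true  nothing  = refl
edge-split true  true  (just _) = refl
edge-split true  false nothing  = refl
edge-split true  false (just _) = refl

sign-budget : ∀ x y s → x ∧ y ≡ false → [ x ∧ isPos s ] + [ y ∧ isNeg s ] ℕ.≤ [ isEdge s ]
sign-budget false false s          _ = z≤n
sign-budget true  false nothing    _ = z≤n
sign-budget true  false (just pos) _ = ℕₚ.≤-refl
sign-budget true  false (just neg) _ = z≤n
sign-budget false true  nothing    _ = z≤n
sign-budget false true  (just pos) _ = z≤n
sign-budget false true  (just neg) _ = ℕₚ.≤-refl
sign-budget true  true  s          ()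

-- A pair (u, v) is counted at most once: u lies in at most one of A, B, and then
-- v's side decides which sign of the edge uv, if any, is counted.
pair-budget : ∀ a b a′ b′ s → a ∧ b ≡ false → a′ ∧ b′ ≡ false →
  [ a ∧ (b′ ∧ isPos s) ] + [ b ∧ (a′ ∧ isPos s) ] + [ a ∧ (a′ ∧ isNeg s) ] + [ b ∧ (b′ ∧ isNeg s) ]
  ℕ.≤ [ a ∨ b ] * [ isEdge s ]
pair-budget false false a′ b′ s _ _ = z≤n
pair-budget true  false a′ b′ s _ a′b′
  rewrite ℕₚ.+-identityʳ [ b′ ∧ isPos s ]
        | ℕₚ.+-identityʳ ([ b′ ∧ isPos s ] + [ a′ ∧ isNeg s ])
        | ℕₚ.+-identityʳ [ isEdge s ]
  = sign-budget b′ a′ s (trans (∧-comm b′ a′) a′b′)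
pair-budget false true  a′ b′ s _ a′b′
  rewrite ℕₚ.+-identityʳ [ a′ ∧ isPos s ] | ℕₚ.+-identityʳ [ isEdge s ]
  = sign-budget a′ b′ s a′b′
pair-budget true  true  a′ b′ s () _

module _ {n : ℕ} (G : SignedGraph n) where

  private
    F : List (Fin n)
    F = allFin n

  sgnIn-⊤ : ∀ u v → sgnIn G ⊤ u v ≡ sgn G u v
  sgnIn-⊤ u v rewrite lookup-⊤ u | lookup-⊤ v = refl

  sgnIn-sym : ∀ S u v → sgnIn G S u v ≡ sgnIn G S v u
  sgnIn-sym S u v rewrite symmetric G u v | ∧-comm (u ∈ᵇ S) (v ∈ᵇ S) = refl

  sgnIn-inside : ∀ {S u v} → u ∈ᵇ S ≡ true → v ∈ᵇ S ≡ true → sgnIn G S u v ≡ sgn G u v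
  sgnIn-inside uˢ vˢ rewrite uˢ | vˢ = refl

  pairs-induced : ∀ {S A B} p → A ⊆ S → B ⊆ S → pairs G S p A B ≡ pairs G ⊤ p A B
  pairs-induced {S} {A} {B} p A⊆S B⊆S =
    sum-map-cong F λ u → sum-map-cong F λ v → same-sign u v
    where
    same-sign : ∀ u v → [ (u ∈ᵇ A) ∧ ((v ∈ᵇ B) ∧ p (sgnIn G S u v)) ]
                      ≡ [ (u ∈ᵇ A) ∧ ((v ∈ᵇ B) ∧ p (sgnIn G ⊤ u v)) ]
    same-sign u v with u ∈ᵇ A in uᴬ | v ∈ᵇ B in vᴮ
    ... | false | _     = refl
    ... | true  | false = refl
    ... | true  | true  = cong (λ s → [ p s ])
      (trans (sgnIn-inside {S} (lookup-⊆ A⊆S uᴬ) (lookup-⊆ B⊆S vᴮ)) (sym (sgnIn-⊤ u v)))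

  pairs-⊥ : ∀ S p A → pairs G S p A ⊥ ≡ 0
  pairs-⊥ S p A =
    trans (sum-map-cong F λ u → trans (sum-map-cong F (no-pair u)) (sum-map-zero F))
          (sum-map-zero F)
    where
    no-pair : ∀ u v → [ (u ∈ᵇ A) ∧ ((v ∈ᵇ ⊥) ∧ p (sgnIn G S u v)) ] ≡ 0
    no-pair u v rewrite lookup-⊥ v | ∧-zeroʳ (u ∈ᵇ A) = refl

  pairs-comm : ∀ S p A B → pairs G S p A B ≡ pairs G S p B A
  pairs-comm S p A B =
    trans (sum-map-comm F F _) (sum-map-cong F λ v → sum-map-cong F λ u → swapped v u)
    where
    swapped : ∀ v u → [ (u ∈ᵇ A) ∧ ((v ∈ᵇ B) ∧ p (sgnIn G S u v)) ]
                    ≡ [ (v ∈ᵇ B) ∧ ((u ∈ᵇ A) ∧ p (sgnIn G S v u)) ]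
    swapped v u = cong [_] (trans (∧-exchange (u ∈ᵇ A) (v ∈ᵇ B) _)
                                  (cong (λ s → (v ∈ᵇ B) ∧ ((u ∈ᵇ A) ∧ p s)) (sgnIn-sym S u v)))

  vol-induced : ∀ S → vol G ⊤ S ≡ vol G S S + cut G S
  vol-induced S = begin
      vol G ⊤ S
    ≡⟨ sum-map-cong F (λ u → sym (sum-map-*ˡ F [ u ∈ᵇ S ] _)) ⟩
      Σ[ (λ u → Σ[ (λ v → [ u ∈ᵇ S ] * [ isEdge (sgnIn G ⊤ u v) ]) ]) ]
    ≡⟨ sum-map-cong F (λ u → sum-map-cong F (split u)) ⟩
      Σ[ (λ u → Σ[ (λ v → inside u v + leaving u v) ]) ]
    ≡⟨ ΣΣ-+ inside leaving ⟩
      Σ[ (λ u → Σ[ inside u ]) ] + cut G S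
    ≡⟨ cong (_+ cut G S) (sum-map-cong F λ u → sum-map-*ˡ F [ u ∈ᵇ S ] _) ⟩
      vol G S S + cut G S
    ∎
    where
    open ≡-Reasoning
    inside leaving : Fin n → Fin n → ℕ
    inside  u v = [ u ∈ᵇ S ] * [ isEdge (sgnIn G S u v) ]
    leaving u v = [ (u ∈ᵇ S) ∧ ((v ∈ᵇ (⊤ ─ S)) ∧ isEdge (sgnIn G ⊤ u v)) ]
    split : ∀ u v → [ u ∈ᵇ S ] * [ isEdge (sgnIn G ⊤ u v) ] ≡ inside u v + leaving u v
    split u v rewrite sgnIn-⊤ u v | lookup-─ ⊤ S v | lookup-⊤ v =
      edge-split (u ∈ᵇ S) (v ∈ᵇ S) (sgn G u v)

  frustration≤vol : ∀ S {A B} → A ∩ B ≡ ⊥ → frustration G S A B ℕ.≤ vol G S (A ∪ B)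
  frustration≤vol S {A} {B} A∩B≡⊥ = begin
      frustration G S A B
    ≡⟨ cong (λ k → k + Σ[ (λ u → Σ[ N⁻ᴬ u ]) ] + Σ[ (λ u → Σ[ N⁻ᴮ u ]) ]) two-sides ⟩
      Σ[ (λ u → Σ[ P⁺ u ]) ] + Σ[ (λ u → Σ[ Q⁺ u ]) ]
        + Σ[ (λ u → Σ[ N⁻ᴬ u ]) ] + Σ[ (λ u → Σ[ N⁻ᴮ u ]) ]
    ≡⟨ sym (trans (ΣΣ-+ (λ u v → P⁺ u v + Q⁺ u v + N⁻ᴬ u v) N⁻ᴮ)
                  (cong (_+ Σ[ (λ u → Σ[ N⁻ᴮ u ]) ])
                        (trans (ΣΣ-+ (λ u v → P⁺ u v + Q⁺ u v) N⁻ᴬ)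
                               (cong (_+ Σ[ (λ u → Σ[ N⁻ᴬ u ]) ]) (ΣΣ-+ P⁺ Q⁺))))) ⟩
      Σ[ (λ u → Σ[ (λ v → P⁺ u v + Q⁺ u v + N⁻ᴬ u v + N⁻ᴮ u v) ]) ]
    ≤⟨ sum-map-mono F (λ u → sum-map-mono F (budget u)) ⟩
      Σ[ (λ u → Σ[ (λ v → [ u ∈ᵇ (A ∪ B) ] * [ isEdge (sgnIn G S u v) ]) ]) ]
    ≡⟨ sum-map-cong F (λ u → sum-map-*ˡ F [ u ∈ᵇ (A ∪ B) ] _) ⟩
      vol G S (A ∪ B)
    ∎
    where
    open ℕₚ.≤-Reasoning
    P⁺ Q⁺ N⁻ᴬ N⁻ᴮ : Fin n → Fin n → ℕ
    P⁺  u v = [ (u ∈ᵇ A) ∧ ((v ∈ᵇ B) ∧ isPos (sgnIn G S u v)) ]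
    Q⁺  u v = [ (u ∈ᵇ B) ∧ ((v ∈ᵇ A) ∧ isPos (sgnIn G S u v)) ]
    N⁻ᴬ u v = [ (u ∈ᵇ A) ∧ ((v ∈ᵇ A) ∧ isNeg (sgnIn G S u v)) ]
    N⁻ᴮ u v = [ (u ∈ᵇ B) ∧ ((v ∈ᵇ B) ∧ isNeg (sgnIn G S u v)) ]
    two-sides : 2 * pairs G S isPos A B ≡ pairs G S isPos A B + pairs G S isPos B A
    two-sides = cong (pairs G S isPos A B +_)
                     (trans (ℕₚ.+-identityʳ _) (pairs-comm S isPos A B))
    budget : ∀ u v → P⁺ u v + Q⁺ u v + N⁻ᴬ u v + N⁻ᴮ u v
                     ℕ.≤ [ u ∈ᵇ (A ∪ B) ] * [ isEdge (sgnIn G S u v) ]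
    budget u v rewrite lookup-∪ A B u =
      pair-budget (u ∈ᵇ A) (u ∈ᵇ B) (v ∈ᵇ A) (v ∈ᵇ B) (sgnIn G S u v)
                  (p∩q≡⊥⇒lookup A∩B≡⊥ u) (p∩q≡⊥⇒lookup A∩B≡⊥ v)

  frustration-induced : ∀ {S A B} → A ⊆ S → B ⊆ S → frustration G S A B ≡ frustration G ⊤ A B
  frustration-induced A⊆S B⊆S =
    cong₂ _+_ (cong₂ _+_ (cong (2 *_) (pairs-induced isPos A⊆S B⊆S))
                         (pairs-induced isNeg A⊆S A⊆S))
              (pairs-induced isNeg B⊆S B⊆S)

  eG-self : ∀ A B → eG G (A ∪ B) A B ≡ frustration G (A ∪ B) A B
  eG-self A B = trans (cong (frustration G S A B +_) no-boundary) (ℕₚ.+-identityʳ _)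
    where
    S : Subset n
    S = A ∪ B
    no-boundary : pairs G S isEdge S (S ─ S) ≡ 0
    no-boundary = trans (cong (pairs G S isEdge S) (p─p≡⊥ S)) (pairs-⊥ S isEdge S)

fromℚᵘ-mono-≤ : ∀ {p q} → p ℚᵘ.≤ q → fromℚᵘ p ≤ fromℚᵘ q
fromℚᵘ-mono-≤ {p} {q} p≤q = ℚₚ.toℚᵘ-cancel-≤
  (ℚᵘₚ.≤-respˡ-≃ (ℚᵘₚ.≃-sym (ℚₚ.toℚᵘ-fromℚᵘ p))
    (ℚᵘₚ.≤-respʳ-≃ (ℚᵘₚ.≃-sym (ℚₚ.toℚᵘ-fromℚᵘ q)) p≤q))

/-mono-cross : ∀ a b c d → a * suc d ℕ.≤ c * suc b → ℤ.+ a / suc b ≤ ℤ.+ c / suc d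
/-mono-cross a b c d ad≤cb = fromℚᵘ-mono-≤ {ℚᵘ.mkℚᵘ (ℤ.+ a) b} {ℚᵘ.mkℚᵘ (ℤ.+ c) d}
  (ℚᵘ.*≤* (subst₂ ℤ._≤_ (ℤₚ.pos-* a (suc d)) (ℤₚ.pos-* c (suc b))
                        (ℤ.+≤+ ad≤cb)))

0≤ratio : ∀ a b → 0ℚ ≤ ratio a b
0≤ratio a zero    = ℚₚ.≤-refl
0≤ratio a (suc b) = /-mono-cross 0 0 a b z≤n

ratio-≤-+ : ∀ {e v} b → e ℕ.≤ v → ratio e v ≤ ratio (e + b) (v + b)
ratio-≤-+ {v = zero}  b z≤n = 0≤ratio b b
ratio-≤-+ {e} {suc v} b e≤v = /-mono-cross e v (e + b) (v + b) (begin
    e * (suc v + b)       ≡⟨ ℕₚ.*-distribˡ-+ e (suc v) b ⟩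
    e * suc v + e * b     ≤⟨ ℕₚ.+-monoʳ-≤ (e * suc v) (ℕₚ.*-monoˡ-≤ b e≤v) ⟩
    e * suc v + suc v * b ≡⟨ cong (e * suc v +_) (ℕₚ.*-comm (suc v) b) ⟩
    e * suc v + b * suc v ≡⟨ ℕₚ.*-distribʳ-+ (suc v) e b ⟨
    (e + b) * suc v       ∎)
  where open ℕₚ.≤-Reasoning

minList-≤ : ∀ {xs z} → z ∈ₗ xs → minList xs ≤ z
minList-≤ {x ∷ xs} {z} z∈x∷xs = foldr-preservesᵒ below x xs (lift z∈x∷xs)
  where
  below : ∀ p q → p ≤ z ⊎ q ≤ z → p ⊓ q ≤ z
  below p q (inj₁ p≤z) = ℚₚ.≤-trans (ℚₚ.p⊓q≤p p q) p≤z
  below p q (inj₂ q≤z) = ℚₚ.≤-trans (ℚₚ.p⊓q≤q p q) q≤z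
  lift : z ∈ₗ x ∷ xs → x ≤ z ⊎ Any.Any (_≤ z) xs
  lift (here z≡x)   = inj₁ (ℚₚ.≤-reflexive (sym z≡x))
  lift (there z∈xs) = inj₂ (Any.map (λ z≡y → ℚₚ.≤-reflexive (sym z≡y)) z∈xs)

minList-greatest : ∀ {y z xs} → z ∈ₗ xs → All (y ≤_) xs → y ≤ minList xs
minList-greatest {xs = x ∷ xs} _ (y≤x ∷ y≤xs) = foldr-preservesᵇ ℚₚ.⊓-glb y≤x y≤xs

∈-allSubsets : ∀ {n} (W : Subset n) → W ∈ₗ allSubsets n
∈-allSubsets []                = here refl
∈-allSubsets {suc n} (true ∷ W)  = ∈-++⁺ˡ (∈-map⁺ (true ∷_) (∈-allSubsets W))
∈-allSubsets {suc n} (false ∷ W) =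
  ∈-++⁺ʳ (map (true ∷_) (allSubsets n)) (∈-map⁺ (false ∷_) (∈-allSubsets W))

nonemptyᵇ-complete : ∀ {n} {p : Subset n} → Nonempty p → nonemptyᵇ p ≡ true
nonemptyᵇ-complete {p = true  ∷ p} _                       = refl
nonemptyᵇ-complete {p = false ∷ p} (Fin.suc x , there x∈p) = nonemptyᵇ-complete (x , x∈p)

module _ {n : ℕ} (G : SignedGraph n) where

  β≤βset : ∀ {S} → Nonempty S → β G S ≤ βset G S S
  β≤βset {S} S-nonempty = minList-≤ (∈-map⁺ (βset G S) (∈-filter⁺ _
    (subst (_∈ₗ map (_∩ S) (allSubsets n)) (∩-idem S) (∈-map⁺ (_∩ S) (∈-allSubsets S)))
    (nonemptyᵇ-complete S-nonempty)))

  βset≤βpair : ∀ S U W → βset G S U ≤ βpair G S (W ∩ U) (U ─ W)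
  βset≤βpair S U W = minList-≤ (∈-map⁺ (λ W → βpair G S (W ∩ U) (U ─ W)) (∈-allSubsets W))

  βset-greatest : ∀ {y} S U → (∀ W → y ≤ βpair G S (W ∩ U) (U ─ W)) → y ≤ βset G S U
  βset-greatest S U y≤ = minList-greatest (∈-map⁺ _ (∈-allSubsets U))
                                          (map⁺ (universal y≤ (allSubsets n)))

  βpair-induced≤ : ∀ {A B} → A ∩ B ≡ ⊥ → βpair G (A ∪ B) A B ≤ βpair G ⊤ A B
  βpair-induced≤ {A} {B} A∩B≡⊥ = begin
      βpair G S A B
    ≡⟨ cong (λ e → ratio e (vol G S S)) (eG-self G A B) ⟩
      ratio (frustration G S A B) (vol G S S)
    ≤⟨ ratio-≤-+ (cut G S) (frustration≤vol G S A∩B≡⊥) ⟩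
      ratio (frustration G S A B + cut G S) (vol G S S + cut G S)
    ≡⟨ cong₂ ratio (cong (_+ cut G S) (frustration-induced G (p⊆p∪q B) (q⊆p∪q A B)))
                   (sym (vol-induced G S)) ⟩
      βpair G ⊤ A B
    ∎
    where
    open ℚₚ.≤-Reasoning
    S : Subset n
    S = A ∪ B

  β≤βpair : ∀ {A B} → A ∩ B ≡ ⊥ → Nonempty (A ∪ B) → β G (A ∪ B) ≤ βpair G ⊤ A B
  β≤βpair {A} {B} A∩B≡⊥ A∪B-nonempty = begin
      β G S                       ≤⟨ β≤βset A∪B-nonempty ⟩
      βset G S S                  ≤⟨ βset≤βpair S S A ⟩
      βpair G S (A ∩ S) (S ─ A)   ≡⟨ cong₂ (βpair G S) (∩-abs-∪ A B) (p∩q≡⊥⇒p∪q─p≡q A∩B≡⊥) ⟩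
      βpair G S A B               ≤⟨ βpair-induced≤ A∩B≡⊥ ⟩
      βpair G ⊤ A B               ∎
    where
    open ℚₚ.≤-Reasoning
    S : Subset n
    S = A ∪ B

lemmaB2 : ∀ {n} (G : SignedGraph n) →
    (∀ (V₁ V₂ : Subset n) →
       (∀ (x : Fin n) → x ∈ V₁ → x ∉ V₂) →
       Nonempty (V₁ ∪ V₂) →
       β G (V₁ ∪ V₂) ≤ βpair G ⊤ V₁ V₂)
    × (∀ (U : Subset n) → Nonempty U → β G U ≤ βset G ⊤ U)
lemmaB2 G = (λ V₁ V₂ disjoint → β≤βpair G (disjoint⇒p∩q≡⊥ disjoint))
          , λ U U-nonempty → βset-greatest G ⊤ U λ W →
              subst (λ S → β G S ≤ βpair G ⊤ (W ∩ U) (U ─ W)) (p∩q∪q─p≡q W U)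
                    (β≤βpair G (p∩q∩q─p≡⊥ W U) (subst Nonempty (sym (p∩q∪q─p≡q W U)) U-nonempty))
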